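{- Let $k$ be a positive integer and let $G$ be the $(6k-1)\times(6k-1)$ grid graph. Then the answer to the Most Clicks Problem on $G$ is at most $26k^2 - 12k + 1$. Moreover, if $d(6k-1) = 2$, the answer to the Most Clicks Problem on $G$ is exactly $26k^2 - 12k + 1$.
   Context: The $m\times m$ grid graph has the cells of an $m\times m$ array as vertices, two being adjacent when they share a side. For a graph $G=(V,E)$ and $v\in V$ let $N[v]$ be the closed neighborhood of $v$, and define $\Phi_G(S) = \{v \in V : \lvert N[v]\cap S\rvert \text{ odd}\}$ for $S\subseteq V$ (the set of lights toggled when each vertex of $S$ is clicked once, clicking a vertex toggling it and its neighbors). An initial configuration $C\subseteq V$ (lights that are on) is solvable if $C = \Phi_G(S)$ for some $S$, called a solution; its minimum number of clicks is $\min\{\lvert S\rvert : \Phi_G(S) = C\}$. The Most Clicks Problem asks for the maximum, over all solvable initial configurations $C$, of the minimum number of clicks needed to solve $C$. $d(m)$ denotes $\dim_{\mathbb{F}_2}\ker \Phi_G$ for $G$ the $m\times m$ grid graph. -}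

module Defs where

open import Data.Nat using (ℕ; zero; suc; _+_; _≤_; _≤ᵇ_; ∣_-_∣)
open import Data.Bool using (Bool; true; false; _∧_; _xor_; not; if_then_else_)
open import Data.Fin using (Fin; toℕ)
open import Data.List using (List; allFin; map)
open import Data.Nat.ListAction using (sum)
open import Data.Product using (_×_; Σ; ∃; _,_)
open import Relation.Binary.PropositionalEquality using (_≡_)

Cell : ℕ → Set
Cell m = Fin m × Fin m

-- A subset of the vertex set (configuration of lights / set of clicks),
-- as its characteristic function.
Config : ℕ → Set
Config m = Fin m → Fin m → Bool

_≈_ : ∀ {m} → Config m → Config m → Set
_≈_ {m} A B = (i j : Fin m) → A i j ≡ B i j

∅ : ∀ {m} → Config m
∅ i j = false

count : ∀ {m} → Config m → ℕ
count {m} A = sum (map (λ i → sum (map (λ j → if A i j then 1 else 0) (allFin m))) (allFin m))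

-- Closed neighbourhood in the grid graph: u ∈ N[v] iff u = v or u, v share a
-- side, i.e. iff the Manhattan distance of the cells is ≤ 1.
inN : ∀ {m} → Cell m → Cell m → Bool
inN (i , j) (i' , j') = (∣ toℕ i - toℕ i' ∣ + ∣ toℕ j - toℕ j' ∣) ≤ᵇ 1

isOdd : ℕ → Bool
isOdd zero = false
isOdd (suc n) = not (isOdd n)

Φ : ∀ {m} → Config m → Config m
Φ S i j = isOdd (count (λ i' j' → inN (i , j) (i' , j') ∧ S i' j'))

Solvable : ∀ {m} → Config m → Set
Solvable {m} C = Σ (Config m) λ S → Φ S ≈ C

IsMinClicks : ∀ {m} → Config m → ℕ → Set
IsMinClicks {m} C n =
  (Σ (Config m) λ S → (Φ S ≈ C) × (count S ≡ n)) ×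
  ((S : Config m) → Φ S ≈ C → n ≤ count S)

-- n is the answer to the Most Clicks Problem on the m×m grid graph:
-- the maximum, over solvable C, of the minimum number of clicks for C.
IsMostClicks : ℕ → ℕ → Set
IsMostClicks m n =
  (Σ (Config m) λ C → IsMinClicks C n) ×
  ((C : Config m) (n' : ℕ) → IsMinClicks C n' → n' ≤ n)

lincomb : ∀ {m} (d : ℕ) → (Fin d → Bool) → (Fin d → Config m) → Config m
lincomb d c b i j = Data.List.foldr _xor_ false (map (λ t → c t ∧ b t i j) (allFin d))

KerDim : ℕ → ℕ → Set
KerDim m d =
  Σ (Fin d → Config m) λ b →
    ((t : Fin d) → Φ (b t) ≈ ∅) ×
    ((c : Fin d → Bool) → lincomb d c b ≈ ∅ → (t : Fin d) → c t ≡ false) ×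
    ((S : Config m) → Φ S ≈ ∅ → Σ (Fin d → Bool) λ c → lincomb d c b ≈ S)

{-# OPTIONS --safe #-}
-- Let u = 1010… and v = 110110… on a path of length m = 6k − 1.  The adjacency matrix A of the
-- path kills u and fixes v, and Φ acts on a product u ⊗ v as A ⊗ I + I ⊗ I + I ⊗ A, so
-- X = u ⊗ v and Y = v ⊗ u lie in ker Φ.  If S is a minimum solution of C with |S| = c, then
-- S, S + X, S + Y, S + X + Y all solve C, so each has at least c cells; cellwise they contain
-- at most 4 − 2[x ∨ y] cells together, whence 4c ≤ 4m² − 2|X ∪ Y| = 4(26k² − 12k + 1).
-- If dim ker Φ = 2, then ker Φ = {0, X, Y, X + Y}, and a configuration containing every cell
-- off X ∪ Y and exactly half of each of X ∖ Y, Y ∖ X, X ∩ Y has all four translates of size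
-- 26k² − 12k + 1.  All counts follow from the period-6 structure of u and v.
module Submission where

open import Defs
open import Data.Bool using (Bool; true; false; not; _∧_; _∨_; _xor_; if_then_else_)
open import Data.Bool.Properties
  using (xor-∧-commutativeRing; xor-same; xor-identityʳ; not-distribˡ-xor; ∧-zeroʳ; ∧-comm; ∧-distribˡ-xor; ∧-conicalˡ)
open import Data.Fin using (Fin; zero; suc; toℕ)
open import Data.Fin.Properties using (toℕ<n)
open import Data.List using (List; foldr; map; tabulate; allFin)
open import Data.List.Properties using (map-tabulate; tabulate-cong; map-cong)
open import Data.Maybe using (just; nothing)
open import Data.Nat using (ℕ; zero; suc; _+_; _*_; _∸_; _≤_; _<_; _≤ᵇ_; _<ᵇ_; _≡ᵇ_; _%_; ∣_-_∣; z≤n; s≤s)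
open import Data.Nat.ListAction using (sum)
open import Data.Nat.Properties
  using (+-assoc; *-zeroʳ; *-distribˡ-+; +-mono-≤; +-monoˡ-≤; ≤-refl; ≤-reflexive; +-cancelʳ-≤; *-cancelˡ-≤;
         m+n∸n≡m; +-commutativeSemigroup; module ≤-Reasoning)
open import Data.Nat.Tactic.RingSolver using (solve-∀)
open import Data.Product using (_×_; Σ; _,_; proj₁; proj₂)
open import Function using (_∘_)
open import Level using (0ℓ)
open import Relation.Binary.PropositionalEquality
import Tactic.RingSolver as RingSolver
import Tactic.RingSolver.Core.AlmostCommutativeRing as ACR

open import Algebra.Properties.CommutativeSemigroup +-commutativeSemigroup using (interchange; x∙yz≈y∙xz)

F₂ : ACR.AlmostCommutativeRing 0ℓ 0ℓ
F₂ = ACR.fromCommutativeRing xor-∧-commutativeRing λ { false → just refl ; true → nothing }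

bit : Bool → ℕ
bit b = if b then 1 else 0

parity : List Bool → Bool
parity = foldr _xor_ false

∑ : ∀ n → (Fin n → ℕ) → ℕ
∑ n f = sum (tabulate f)

⨁ : ∀ n → (Fin n → Bool) → Bool
⨁ n f = parity (tabulate f)

∑-cong : ∀ n {f g : Fin n → ℕ} → (∀ i → f i ≡ g i) → ∑ n f ≡ ∑ n g
∑-cong n f≗g = cong sum (tabulate-cong f≗g)

⨁-cong : ∀ n {f g : Fin n → Bool} → (∀ i → f i ≡ g i) → ⨁ n f ≡ ⨁ n g
⨁-cong n f≗g = cong parity (tabulate-cong f≗g)

∑-+ : ∀ n (f g : Fin n → ℕ) → ∑ n (λ i → f i + g i) ≡ ∑ n f + ∑ n g
∑-+ zero    f g = refl
∑-+ (suc n) f g = trans (cong (f zero + g zero +_) (∑-+ n (f ∘ suc) (g ∘ suc)))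
                        (interchange (f zero) (g zero) (∑ n (f ∘ suc)) (∑ n (g ∘ suc)))

∑-* : ∀ n c (f : Fin n → ℕ) → ∑ n (λ i → c * f i) ≡ c * ∑ n f
∑-* zero    c f = sym (*-zeroʳ c)
∑-* (suc n) c f = trans (cong (c * f zero +_) (∑-* n c (f ∘ suc))) (sym (*-distribˡ-+ c (f zero) _))

∑-affine : ∀ n c (f g : Fin n → ℕ) → ∑ n (λ i → f i + c * g i) ≡ ∑ n f + c * ∑ n g
∑-affine n c f g = trans (∑-+ n f (λ i → c * g i)) (cong (∑ n f +_) (∑-* n c g))

∑-mono : ∀ n {f g : Fin n → ℕ} → (∀ i → f i ≤ g i) → ∑ n f ≤ ∑ n g
∑-mono zero    f≤g = z≤n
∑-mono (suc n) f≤g = +-mono-≤ (f≤g zero) (∑-mono n (f≤g ∘ suc))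

isOdd-+ : ∀ a b → isOdd (a + b) ≡ isOdd a xor isOdd b
isOdd-+ zero    b = refl
isOdd-+ (suc a) b = trans (cong not (isOdd-+ a b)) (not-distribˡ-xor (isOdd a) (isOdd b))

isOdd-bit : ∀ b → isOdd (bit b) ≡ b
isOdd-bit true  = refl
isOdd-bit false = refl

isOdd-∑ : ∀ n (f : Fin n → ℕ) → isOdd (∑ n f) ≡ ⨁ n (isOdd ∘ f)
isOdd-∑ zero    f = refl
isOdd-∑ (suc n) f = trans (isOdd-+ (f zero) _) (cong (isOdd (f zero) xor_) (isOdd-∑ n (f ∘ suc)))

⨁-xor : ∀ n (f g : Fin n → Bool) → ⨁ n (λ i → f i xor g i) ≡ ⨁ n f xor ⨁ n g
⨁-xor zero    f g = refl
⨁-xor (suc n) f g = trans (cong ((f zero xor g zero) xor_) (⨁-xor n (f ∘ suc) (g ∘ suc)))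
                          (interchange-xor (f zero) (g zero) _ _)
  where
  interchange-xor : ∀ a b c d → (a xor b) xor (c xor d) ≡ (a xor c) xor (b xor d)
  interchange-xor = RingSolver.solve-∀ F₂

⨁-∧ˡ : ∀ n c (f : Fin n → Bool) → ⨁ n (λ i → c ∧ f i) ≡ c ∧ ⨁ n f
⨁-∧ˡ zero    c f = sym (∧-zeroʳ c)
⨁-∧ˡ (suc n) c f = trans (cong ((c ∧ f zero) xor_) (⨁-∧ˡ n c (f ∘ suc))) (sym (∧-distribˡ-xor c (f zero) _))

⨁-⊗ : ∀ m n (f : Fin m → Bool) (g : Fin n → Bool) → ⨁ m (λ a → ⨁ n (λ b → f a ∧ g b)) ≡ ⨁ m f ∧ ⨁ n g
⨁-⊗ m n f g = begin
  ⨁ m (λ a → ⨁ n (λ b → f a ∧ g b)) ≡⟨ ⨁-cong m (λ a → trans (⨁-∧ˡ n (f a) g) (∧-comm (f a) _)) ⟩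
  ⨁ m (λ a → ⨁ n g ∧ f a)           ≡⟨ ⨁-∧ˡ m (⨁ n g) f ⟩
  ⨁ n g ∧ ⨁ m f                     ≡⟨ ∧-comm (⨁ n g) _ ⟩
  ⨁ m f ∧ ⨁ n g                     ∎
  where open ≡-Reasoning

⨁²-xor : ∀ m n (f g : Fin m → Fin n → Bool) →
  ⨁ m (λ a → ⨁ n (λ b → f a b xor g a b)) ≡ ⨁ m (λ a → ⨁ n (f a)) xor ⨁ m (λ a → ⨁ n (g a))
⨁²-xor m n f g = trans (⨁-cong m (λ a → ⨁-xor n (f a) (g a))) (⨁-xor m _ _)

∑-split : ∀ a b (f : ℕ → ℕ) → ∑ (a + b) (f ∘ toℕ) ≡ ∑ a (f ∘ toℕ) + ∑ b (λ i → f (a + toℕ i))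
∑-split zero    b f = refl
∑-split (suc a) b f = trans (cong (f 0 +_) (∑-split a b (f ∘ suc))) (sym (+-assoc (f 0) _ _))

∑-repeat : ∀ d k (f : ℕ → ℕ) → (∀ a → f (d + a) ≡ f a) → ∑ (k * d) (f ∘ toℕ) ≡ k * ∑ d (f ∘ toℕ)
∑-repeat d zero    f periodic = refl
∑-repeat d (suc k) f periodic =
  trans (∑-split d (k * d) f)
        (cong (∑ d (f ∘ toℕ) +_) (trans (∑-cong (k * d) (periodic ∘ toℕ)) (∑-repeat d k f periodic)))

periodicSum : ℕ → ℕ → ℕ → (ℕ → ℕ) → ℕ
periodicSum r d k f = ∑ r (f ∘ toℕ) + k * ∑ d (λ i → f (r + toℕ i))

∑-periodic : ∀ r d k (f : ℕ → ℕ) → (∀ a → f (d + a) ≡ f a) → ∑ (r + k * d) (f ∘ toℕ) ≡ periodicSum r d k f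
∑-periodic r d k f periodic =
  trans (∑-split r (k * d) f)
        (cong (∑ r (f ∘ toℕ) +_) (∑-repeat d k (λ a → f (r + a)) shifted-periodic))
  where
  shifted-periodic : ∀ a → f (r + (d + a)) ≡ f (r + a)
  shifted-periodic a = trans (cong f (x∙yz≈y∙xz r d a)) (periodic (r + a))

periodicSum-affine : ∀ r d k c (f g : ℕ → ℕ) →
  periodicSum r d k (λ a → f a + c * g a) ≡ periodicSum r d k f + c * periodicSum r d k g
periodicSum-affine r d k c f g =
  trans (cong₂ (λ u v → u + k * v) (∑-affine r c (f ∘ toℕ) (g ∘ toℕ)) (∑-affine d c _ _))
        (regroup (∑ r (f ∘ toℕ)) (∑ r (g ∘ toℕ)) (∑ d (λ i → f (r + toℕ i))) (∑ d (λ i → g (r + toℕ i))) k c)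
  where
  regroup : ∀ f₀ g₀ f₁ g₁ k c → (f₀ + c * g₀) + k * (f₁ + c * g₁) ≡ (f₀ + k * f₁) + c * (g₀ + k * g₁)
  regroup = solve-∀

∑² : ∀ m → (Fin m → Fin m → ℕ) → ℕ
∑² m f = ∑ m (λ i → ∑ m (f i))

∑²-+ : ∀ m (f g : Fin m → Fin m → ℕ) → ∑² m (λ i j → f i j + g i j) ≡ ∑² m f + ∑² m g
∑²-+ m f g = trans (∑-cong m (λ i → ∑-+ m (f i) (g i))) (∑-+ m _ _)

∑²-* : ∀ m c (f : Fin m → Fin m → ℕ) → ∑² m (λ i j → c * f i j) ≡ c * ∑² m f
∑²-* m c f = trans (∑-cong m (λ i → ∑-* m c (f i))) (∑-* m c _)

∑²-mono : ∀ m {f g : Fin m → Fin m → ℕ} → (∀ i j → f i j ≤ g i j) → ∑² m f ≤ ∑² m g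
∑²-mono m f≤g = ∑-mono m (λ i → ∑-mono m (f≤g i))

count≡∑² : ∀ {m} (A : Config m) → count A ≡ ∑² m (λ i j → bit (A i j))
count≡∑² {m} A = trans (cong sum (map-tabulate (λ i → i) row)) (∑-cong m (λ i → cong sum (map-tabulate (λ j → j) (bit ∘ A i))))
  where
  row : Fin m → ℕ
  row i = sum (map (bit ∘ A i) (allFin m))

count-cong : ∀ {m} {A B : Config m} → A ≈ B → count A ≡ count B
count-cong {m} A≈B = cong sum (map-cong (λ i → cong sum (map-cong (λ j → cong bit (A≈B i j)) (allFin m))) (allFin m))

isOdd-count : ∀ {m} (A : Config m) → isOdd (count A) ≡ ⨁ m (λ i → ⨁ m (A i))
isOdd-count {m} A = begin
  isOdd (count A)                                   ≡⟨ cong isOdd (count≡∑² A) ⟩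
  isOdd (∑² m (λ i j → bit (A i j)))                 ≡⟨ isOdd-∑ m _ ⟩
  ⨁ m (λ i → isOdd (∑ m (λ j → bit (A i j))))        ≡⟨ ⨁-cong m (λ i → isOdd-∑ m _) ⟩
  ⨁ m (λ i → ⨁ m (λ j → isOdd (bit (A i j))))        ≡⟨ ⨁-cong m (λ i → ⨁-cong m (λ j → isOdd-bit (A i j))) ⟩
  ⨁ m (λ i → ⨁ m (A i))                             ∎
  where open ≡-Reasoning

count-periodic : ∀ r d k (G : ℕ → ℕ → Bool) → (∀ a b → G (d + a) b ≡ G a b) → (∀ a b → G a (d + b) ≡ G a b) →
  count {r + k * d} (λ i j → G (toℕ i) (toℕ j))
    ≡ periodicSum r d k (λ a → ∑ r (λ j → bit (G a (toℕ j)))) + k * periodicSum r d k (λ a → ∑ d (λ j → bit (G a (r + toℕ j))))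
count-periodic r d k G periodicˡ periodicʳ = begin
  count {m} (λ i j → G (toℕ i) (toℕ j))
    ≡⟨ count≡∑² {m} (λ i j → G (toℕ i) (toℕ j)) ⟩
  ∑ m (λ i → ∑ m (λ j → bit (G (toℕ i) (toℕ j))))
    ≡⟨ ∑-cong m (λ i → ∑-periodic r d k (λ b → bit (G (toℕ i) b)) (λ b → cong bit (periodicʳ (toℕ i) b))) ⟩
  ∑ m (λ i → rowSum (toℕ i))
    ≡⟨ ∑-periodic r d k rowSum rowSum-periodic ⟩
  periodicSum r d k rowSum
    ≡⟨ periodicSum-affine r d k k (λ a → ∑ r (λ j → bit (G a (toℕ j)))) (λ a → ∑ d (λ j → bit (G a (r + toℕ j)))) ⟩
  periodicSum r d k (λ a → ∑ r (λ j → bit (G a (toℕ j)))) + k * periodicSum r d k (λ a → ∑ d (λ j → bit (G a (r + toℕ j))))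
    ∎
  where
  open ≡-Reasoning
  m = r + k * d
  rowSum : ℕ → ℕ
  rowSum a = periodicSum r d k (λ b → bit (G a b))
  rowSum-periodic : ∀ a → rowSum (d + a) ≡ rowSum a
  rowSum-periodic a = cong₂ (λ u v → u + k * v) (∑-cong r (λ j → cong bit (periodicˡ a (toℕ j))))
                                                 (∑-cong d (λ j → cong bit (periodicˡ a (r + toℕ j))))

infixl 23 _·_
infixl 22 _⊕_ _∪_

_⊕_ : ∀ {m} → Config m → Config m → Config m
(A ⊕ B) i j = A i j xor B i j

_∪_ : ∀ {m} → Config m → Config m → Config m
(A ∪ B) i j = A i j ∨ B i j

_·_ : ∀ {m} → Bool → Config m → Config m
(α · A) i j = α ∧ A i j

full : ∀ {m} → Config m
full i j = true

Φ-⊕ : ∀ {m} (A B : Config m) → Φ (A ⊕ B) ≈ Φ A ⊕ Φ B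
Φ-⊕ {m} A B i j = begin
  Φ (A ⊕ B) i j
    ≡⟨ isOdd-count (λ a b → N a b ∧ (A a b xor B a b)) ⟩
  ⨁ m (λ a → ⨁ m (λ b → N a b ∧ (A a b xor B a b)))
    ≡⟨ ⨁-cong m (λ a → ⨁-cong m (λ b → ∧-distribˡ-xor (N a b) (A a b) (B a b))) ⟩
  ⨁ m (λ a → ⨁ m (λ b → (N a b ∧ A a b) xor (N a b ∧ B a b)))
    ≡⟨ ⨁²-xor m m _ _ ⟩
  ⨁ m (λ a → ⨁ m (λ b → N a b ∧ A a b)) xor ⨁ m (λ a → ⨁ m (λ b → N a b ∧ B a b))
    ≡⟨ cong₂ _xor_ (isOdd-count (λ a b → N a b ∧ A a b)) (isOdd-count (λ a b → N a b ∧ B a b)) ⟨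
  Φ A i j xor Φ B i j
    ∎
  where
  open ≡-Reasoning
  N : Fin m → Fin m → Bool
  N a b = inN (i , j) (a , b)

solution-⊕-kernel : ∀ {m} {S K C : Config m} → Φ S ≈ C → Φ K ≈ ∅ → Φ (S ⊕ K) ≈ C
solution-⊕-kernel {S = S} {K} {C} ΦS≈C ΦK≈∅ i j =
  trans (Φ-⊕ S K i j) (trans (cong₂ _xor_ (ΦS≈C i j) (ΦK≈∅ i j)) (xor-identityʳ (C i j)))

_⊗_ : ∀ {m} → (ℕ → Bool) → (ℕ → Bool) → Config m
(p ⊗ q) i j = p (toℕ i) ∧ q (toℕ j)

adjacentParity : (m : ℕ) → (ℕ → Bool) → ℕ → Bool
adjacentParity m p i = ⨁ m (λ a → (∣ i - toℕ a ∣ ≡ᵇ 1) ∧ p (toℕ a))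

⨁-point : ∀ m i (p : ℕ → Bool) → i < m → ⨁ m (λ a → (∣ i - toℕ a ∣ ≡ᵇ 0) ∧ p (toℕ a)) ≡ p i
⨁-point (suc m) zero    p _         = trans (cong (p 0 xor_) (⨁-∧ˡ m false (p ∘ suc ∘ toℕ))) (xor-identityʳ (p 0))
⨁-point (suc m) (suc i) p (s≤s i<m) = ⨁-point m i (p ∘ suc) i<m

closedNeighbourhood-split : ∀ d e →
  (d + e ≤ᵇ 1) ≡ (((d ≡ᵇ 0) ∧ (e ≡ᵇ 1)) xor ((d ≡ᵇ 0) ∧ (e ≡ᵇ 0))) xor ((d ≡ᵇ 1) ∧ (e ≡ᵇ 0))
closedNeighbourhood-split 0             0             = refl
closedNeighbourhood-split 0             1             = refl
closedNeighbourhood-split 0             (suc (suc e)) = refl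
closedNeighbourhood-split 1             0             = refl
closedNeighbourhood-split 1             (suc e)       = refl
closedNeighbourhood-split (suc (suc d)) e             = refl

Φ-⊗ : ∀ {m} (p q : ℕ → Bool) (i j : Fin m) →
  Φ (p ⊗ q) i j ≡ ((p (toℕ i) ∧ adjacentParity m q (toℕ j)) xor (p (toℕ i) ∧ q (toℕ j)))
                  xor (adjacentParity m p (toℕ i) ∧ q (toℕ j))
Φ-⊗ {m} p q i j = begin
  Φ (p ⊗ q) i j
    ≡⟨ isOdd-count (λ a b → inN (i , j) (a , b) ∧ (p ⊗ q) a b) ⟩
  ⨁ m (λ a → ⨁ m (λ b → inN (i , j) (a , b) ∧ (p ⊗ q) a b))
    ≡⟨ ⨁-cong m (λ a → ⨁-cong m (λ b → separate (d a) (e b) (p (toℕ a)) (q (toℕ b)))) ⟩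
  ⨁ m (λ a → ⨁ m (λ b → ((P₀ a ∧ Q₁ b) xor (P₀ a ∧ Q₀ b)) xor (P₁ a ∧ Q₀ b)))
    ≡⟨ trans (⨁²-xor m m _ _) (cong (_xor ⨁ m (λ a → ⨁ m (λ b → P₁ a ∧ Q₀ b))) (⨁²-xor m m _ _)) ⟩
  (⨁ m (λ a → ⨁ m (λ b → P₀ a ∧ Q₁ b)) xor ⨁ m (λ a → ⨁ m (λ b → P₀ a ∧ Q₀ b)))
    xor ⨁ m (λ a → ⨁ m (λ b → P₁ a ∧ Q₀ b))
    ≡⟨ cong₂ _xor_ (cong₂ _xor_ (⨁-⊗ m m P₀ Q₁) (⨁-⊗ m m P₀ Q₀)) (⨁-⊗ m m P₁ Q₀) ⟩
  ((⨁ m P₀ ∧ ⨁ m Q₁) xor (⨁ m P₀ ∧ ⨁ m Q₀)) xor (⨁ m P₁ ∧ ⨁ m Q₀)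
    ≡⟨ cong₂ (λ x y → ((x ∧ ⨁ m Q₁) xor (x ∧ y)) xor (⨁ m P₁ ∧ y))
             (⨁-point m (toℕ i) p (toℕ<n i)) (⨁-point m (toℕ j) q (toℕ<n j)) ⟩
  ((p (toℕ i) ∧ adjacentParity m q (toℕ j)) xor (p (toℕ i) ∧ q (toℕ j))) xor (adjacentParity m p (toℕ i) ∧ q (toℕ j))
    ∎
  where
  open ≡-Reasoning
  d e : Fin m → ℕ
  d a = ∣ toℕ i - toℕ a ∣
  e b = ∣ toℕ j - toℕ b ∣
  P₀ P₁ Q₀ Q₁ : Fin m → Bool
  P₀ a = (d a ≡ᵇ 0) ∧ p (toℕ a)
  P₁ a = (d a ≡ᵇ 1) ∧ p (toℕ a)
  Q₀ b = (e b ≡ᵇ 0) ∧ q (toℕ b)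
  Q₁ b = (e b ≡ᵇ 1) ∧ q (toℕ b)
  separate : ∀ d e x y → (d + e ≤ᵇ 1) ∧ (x ∧ y) ≡
    ((((d ≡ᵇ 0) ∧ x) ∧ ((e ≡ᵇ 1) ∧ y)) xor (((d ≡ᵇ 0) ∧ x) ∧ ((e ≡ᵇ 0) ∧ y))) xor (((d ≡ᵇ 1) ∧ x) ∧ ((e ≡ᵇ 0) ∧ y))
  separate d e x y = trans (cong (_∧ (x ∧ y)) (closedNeighbourhood-split d e))
                           (distribute (d ≡ᵇ 0) (d ≡ᵇ 1) (e ≡ᵇ 0) (e ≡ᵇ 1) x y)
    where
    distribute : ∀ d₀ d₁ e₀ e₁ x y → (((d₀ ∧ e₁) xor (d₀ ∧ e₀)) xor (d₁ ∧ e₀)) ∧ (x ∧ y) ≡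
      (((d₀ ∧ x) ∧ (e₁ ∧ y)) xor ((d₀ ∧ x) ∧ (e₀ ∧ y))) xor ((d₁ ∧ x) ∧ (e₀ ∧ y))
    distribute = RingSolver.solve-∀ F₂

left : (ℕ → Bool) → ℕ → Bool
left p zero    = false
left p (suc j) = p j

-- The right neighbour of j = m − 1 is m, outside the path; p m ≡ false makes counting it harmless.
adjacentParity-path : ∀ m j (p : ℕ → Bool) → j < m → p m ≡ false → adjacentParity m p j ≡ left p j xor p (suc j)
adjacentParity-path (suc zero)    zero    p _         p₁≡false = sym p₁≡false
adjacentParity-path (suc (suc m)) zero    p _         _        = ⨁-point (suc m) 0 (p ∘ suc) (s≤s z≤n)
adjacentParity-path (suc m)       (suc j) p (s≤s j<m) pₘ≡false =
  trans (cong (((suc j ≡ᵇ 1) ∧ p 0) xor_) (adjacentParity-path m j (p ∘ suc) j<m pₘ≡false)) (step j)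
  where
  step : ∀ j → ((suc j ≡ᵇ 1) ∧ p 0) xor (left (p ∘ suc) j xor p (suc (suc j))) ≡ left p (suc j) xor p (suc (suc j))
  step zero    = refl
  step (suc j) = refl

⊗-kernel : ∀ {m} (p q : ℕ → Bool) →
  (∀ i → i < m → adjacentParity m p i ≡ false) → (∀ j → j < m → adjacentParity m q j ≡ q j) →
  Φ {m} (p ⊗ q) ≈ ∅ × Φ {m} (q ⊗ p) ≈ ∅
⊗-kernel {m} p q Ap≡0 Aq≡q = Φ[p⊗q]≈∅ , Φ[q⊗p]≈∅
  where
  Φ[p⊗q]≈∅ : Φ {m} (p ⊗ q) ≈ ∅
  Φ[p⊗q]≈∅ i j = trans (Φ-⊗ p q i j)
    (trans (cong₂ (λ a x → ((p (toℕ i) ∧ a) xor (p (toℕ i) ∧ q (toℕ j))) xor (x ∧ q (toℕ j)))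
                  (Aq≡q (toℕ j) (toℕ<n j)) (Ap≡0 (toℕ i) (toℕ<n i)))
           (cong (_xor false) (xor-same (p (toℕ i) ∧ q (toℕ j)))))
  Φ[q⊗p]≈∅ : Φ {m} (q ⊗ p) ≈ ∅
  Φ[q⊗p]≈∅ i j = trans (Φ-⊗ q p i j)
    (trans (cong₂ (λ x a → ((q (toℕ i) ∧ x) xor (q (toℕ i) ∧ p (toℕ j))) xor (a ∧ p (toℕ j)))
                  (Ap≡0 (toℕ j) (toℕ<n j)) (Aq≡q (toℕ i) (toℕ<n i)))
           (trans (cong (λ z → (z xor (q (toℕ i) ∧ p (toℕ j))) xor (q (toℕ i) ∧ p (toℕ j))) (∧-zeroʳ (q (toℕ i))))
                  (xor-same (q (toℕ i) ∧ p (toℕ j)))))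

translate-bits : ∀ s x y → bit s + bit (s xor x) + bit (s xor y) + bit (s xor (x xor y)) + 2 * bit (x ∨ y) ≤ 4
translate-bits false false false = z≤n
translate-bits false false true  = ≤-refl
translate-bits false true  false = ≤-refl
translate-bits false true  true  = ≤-refl
translate-bits true  false false = ≤-refl
translate-bits true  false true  = ≤-refl
translate-bits true  true  false = ≤-refl
translate-bits true  true  true  = ≤-refl

translates-count : ∀ {m} (S X Y : Config m) →
  count S + count (S ⊕ X) + count (S ⊕ Y) + count (S ⊕ (X ⊕ Y)) + 2 * count (X ∪ Y) ≤ 4 * count {m} full
translates-count {m} S X Y = begin
  count S + count (S ⊕ X) + count (S ⊕ Y) + count (S ⊕ (X ⊕ Y)) + 2 * count (X ∪ Y)
    ≡⟨ cong₂ _+_ (cong₂ _+_ (cong₂ _+_ (cong₂ _+_ (count≡∑² S) (count≡∑² (S ⊕ X))) (count≡∑² (S ⊕ Y)))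
                            (count≡∑² (S ⊕ (X ⊕ Y))))
                 (cong (2 *_) (count≡∑² (X ∪ Y))) ⟩
  ∑² m (bits S) + ∑² m (bits (S ⊕ X)) + ∑² m (bits (S ⊕ Y)) + ∑² m (bits (S ⊕ (X ⊕ Y))) + 2 * ∑² m (bits (X ∪ Y))
    ≡⟨ cong₂ _+_ (trans (∑²-+ m _ (bits (S ⊕ (X ⊕ Y))))
                        (cong (_+ ∑² m (bits (S ⊕ (X ⊕ Y))))
                              (trans (∑²-+ m _ (bits (S ⊕ Y)))
                                     (cong (_+ ∑² m (bits (S ⊕ Y))) (∑²-+ m (bits S) (bits (S ⊕ X)))))))
                 (∑²-* m 2 (bits (X ∪ Y))) ⟨
  ∑² m (λ i j → bits S i j + bits (S ⊕ X) i j + bits (S ⊕ Y) i j + bits (S ⊕ (X ⊕ Y)) i j)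
    + ∑² m (λ i j → 2 * bits (X ∪ Y) i j)
    ≡⟨ ∑²-+ m _ _ ⟨
  ∑² m (λ i j → bit (S i j) + bit (S i j xor X i j) + bit (S i j xor Y i j) + bit (S i j xor (X i j xor Y i j))
                + 2 * bit (X i j ∨ Y i j))
    ≤⟨ ∑²-mono m (λ i j → translate-bits (S i j) (X i j) (Y i j)) ⟩
  ∑² m (λ i j → 4 * bit true)
    ≡⟨ ∑²-* m 4 (λ i j → bit true) ⟩
  4 * ∑² m (bits full)
    ≡⟨ cong (4 *_) (count≡∑² {m} full) ⟨
  4 * count {m} full
    ∎
  where
  open ≤-Reasoning
  bits : Config m → Fin m → Fin m → ℕ
  bits A i j = bit (A i j)

min-clicks-bound : ∀ {m} {X Y C : Config m} {c} → Φ X ≈ ∅ → Φ Y ≈ ∅ → IsMinClicks C c →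
  4 * c + 2 * count (X ∪ Y) ≤ 4 * count {m} full
min-clicks-bound {m} {X} {Y} {C} {c} ΦX≈∅ ΦY≈∅ ((S , ΦS≈C , |S|≡c) , minimal) = begin
  4 * c + 2 * count (X ∪ Y)
    ≡⟨ cong (_+ 2 * count (X ∪ Y)) (four-times c) ⟩
  c + c + c + c + 2 * count (X ∪ Y)
    ≤⟨ +-monoˡ-≤ (2 * count (X ∪ Y))
         (+-mono-≤ (+-mono-≤ (+-mono-≤ (≤-reflexive (sym |S|≡c)) (translate ΦX≈∅)) (translate ΦY≈∅))
                   (translate (solution-⊕-kernel ΦX≈∅ ΦY≈∅))) ⟩
  count S + count (S ⊕ X) + count (S ⊕ Y) + count (S ⊕ (X ⊕ Y)) + 2 * count (X ∪ Y)
    ≤⟨ translates-count S X Y ⟩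
  4 * count {m} full
    ∎
  where
  open ≤-Reasoning
  translate : ∀ {K} → Φ K ≈ ∅ → c ≤ count (S ⊕ K)
  translate ΦK≈∅ = minimal (S ⊕ _) (solution-⊕-kernel ΦS≈C ΦK≈∅)
  four-times : ∀ c → 4 * c ≡ c + c + c + c
  four-times = solve-∀

dot : Bool × Bool → Bool × Bool → Bool
dot (a₀ , a₁) (e₀ , e₁) = (a₀ ∧ e₀) xor (a₁ ∧ e₁)

det : Bool × Bool → Bool × Bool → Bool
det (a₀ , a₁) (b₀ , b₁) = (a₀ ∧ b₁) xor (a₁ ∧ b₀)

cauchy-binet : ∀ x y e f → (dot x e ∧ dot y f) xor (dot x f ∧ dot y e) ≡ det x y ∧ det e f
cauchy-binet (x₀ , x₁) (y₀ , y₁) (e₀ , e₁) (f₀ , f₁) = identity x₀ x₁ y₀ y₁ e₀ e₁ f₀ f₁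
  where
  identity : ∀ x₀ x₁ y₀ y₁ e₀ e₁ f₀ f₁ →
    ((((x₀ ∧ e₀) xor (x₁ ∧ e₁)) ∧ ((y₀ ∧ f₀) xor (y₁ ∧ f₁))) xor (((x₀ ∧ f₀) xor (x₁ ∧ f₁)) ∧ ((y₀ ∧ e₀) xor (y₁ ∧ e₁))))
    ≡ ((x₀ ∧ y₁) xor (x₁ ∧ y₀)) ∧ ((e₀ ∧ f₁) xor (e₁ ∧ f₀))
  identity = RingSolver.solve-∀ F₂

cramer : ∀ x y c e → det x y ∧ dot c e ≡ (det c y ∧ dot x e) xor (det x c ∧ dot y e)
cramer (x₀ , x₁) (y₀ , y₁) (c₀ , c₁) (e₀ , e₁) = identity x₀ x₁ y₀ y₁ c₀ c₁ e₀ e₁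
  where
  identity : ∀ x₀ x₁ y₀ y₁ c₀ c₁ e₀ e₁ →
    ((x₀ ∧ y₁) xor (x₁ ∧ y₀)) ∧ ((c₀ ∧ e₀) xor (c₁ ∧ e₁))
    ≡ (((c₀ ∧ y₁) xor (c₁ ∧ y₀)) ∧ ((x₀ ∧ e₀) xor (x₁ ∧ e₁))) xor (((x₀ ∧ c₁) xor (x₁ ∧ c₀)) ∧ ((y₀ ∧ e₀) xor (y₁ ∧ e₁)))
  identity = RingSolver.solve-∀ F₂

KernelSpannedBy : ∀ {m} → Config m → Config m → Set
KernelSpannedBy {m} X Y = (K : Config m) → Φ K ≈ ∅ → Σ Bool λ α → Σ Bool λ β → K ≈ α · X ⊕ β · Y

-- The coordinates x, y of X, Y in a basis of ker Φ form an invertible matrix (Cauchy–Binet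
-- against the basis values at the two cells), so by Cramer's rule every coordinate vector c
-- equals det(c, y) x + det(x, c) y.
kernel-spanned : ∀ {m} {X Y : Config m} → KerDim m 2 → Φ X ≈ ∅ → Φ Y ≈ ∅ →
  (i₀ j₀ i₁ j₁ : Fin m) → X i₀ j₀ ≡ true → Y i₀ j₀ ≡ true → X i₁ j₁ ≡ true → Y i₁ j₁ ≡ false →
  KernelSpannedBy X Y
kernel-spanned {m} {X} {Y} (b , _ , _ , span) ΦX≈∅ ΦY≈∅ i₀ j₀ i₁ j₁ X₀ Y₀ X₁ Y₁ K ΦK≈∅ =
  det c y , det x c , K≈
  where
  basis : Fin m → Fin m → Bool × Bool
  basis i j = b zero i j , b (suc zero) i j

  coordinates : ∀ {Z} → Φ Z ≈ ∅ → Σ (Bool × Bool) λ z → ∀ i j → Z i j ≡ dot z (basis i j)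
  coordinates {Z} ΦZ≈∅ with span Z ΦZ≈∅
  ... | c , Z≈ = (c zero , c (suc zero)) ,
        λ i j → trans (sym (Z≈ i j)) (cong ((c zero ∧ b zero i j) xor_) (xor-identityʳ (c (suc zero) ∧ b (suc zero) i j)))

  x = proj₁ (coordinates ΦX≈∅)
  y = proj₁ (coordinates ΦY≈∅)
  c = proj₁ (coordinates ΦK≈∅)
  X≡ = proj₂ (coordinates ΦX≈∅)
  Y≡ = proj₂ (coordinates ΦY≈∅)

  det[x,y]≡true : det x y ≡ true
  det[x,y]≡true = ∧-conicalˡ (det x y) (det e f) (begin
    det x y ∧ det e f
      ≡⟨ cauchy-binet x y e f ⟨
    (dot x e ∧ dot y f) xor (dot x f ∧ dot y e)
      ≡⟨ cong₂ _xor_ (cong₂ _∧_ (X≡ i₀ j₀) (Y≡ i₁ j₁)) (cong₂ _∧_ (X≡ i₁ j₁) (Y≡ i₀ j₀)) ⟨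
    (X i₀ j₀ ∧ Y i₁ j₁) xor (X i₁ j₁ ∧ Y i₀ j₀)
      ≡⟨ cong₂ _xor_ (cong₂ _∧_ X₀ Y₁) (cong₂ _∧_ X₁ Y₀) ⟩
    (true ∧ false) xor (true ∧ true)
      ∎)
    where
    open ≡-Reasoning
    e f : Bool × Bool
    e = basis i₀ j₀
    f = basis i₁ j₁

  K≈ : K ≈ det c y · X ⊕ det x c · Y
  K≈ i j = begin
    K i j                                                     ≡⟨ proj₂ (coordinates ΦK≈∅) i j ⟩
    dot c (basis i j)                                         ≡⟨ cong (_∧ dot c (basis i j)) det[x,y]≡true ⟨
    det x y ∧ dot c (basis i j)                               ≡⟨ cramer x y c (basis i j) ⟩
    (det c y ∧ dot x (basis i j)) xor (det x c ∧ dot y (basis i j))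
      ≡⟨ cong₂ (λ u v → (det c y ∧ u) xor (det x c ∧ v)) (X≡ i j) (Y≡ i j) ⟨
    (det c y ∧ X i j) xor (det x c ∧ Y i j)                   ∎
    where open ≡-Reasoning

min-clicks-balanced : ∀ {m} {S X Y : Config m} {c} → KernelSpannedBy X Y →
  (∀ α β → count (S ⊕ (α · X ⊕ β · Y)) ≡ c) → IsMinClicks (Φ S) c
min-clicks-balanced {m} {S} {X} {Y} {c} spanned |S⊕K|≡c =
  (S , (λ i j → refl) , trans (count-cong (λ i j → sym (xor-identityʳ (S i j)))) (|S⊕K|≡c false false)) , minimal
  where
  minimal : (S′ : Config m) → Φ S′ ≈ Φ S → c ≤ count S′
  minimal S′ ΦS′≈ΦS with spanned (S′ ⊕ S) (λ i j → trans (Φ-⊕ S′ S i j) (trans (cong (_xor Φ S i j) (ΦS′≈ΦS i j)) (xor-same (Φ S i j))))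
  ... | α , β , S′⊕S≈ = ≤-reflexive (trans (sym (|S⊕K|≡c α β)) (count-cong S′≈))
    where
    S′≈ : S ⊕ (α · X ⊕ β · Y) ≈ S′
    S′≈ i j = trans (cong (S i j xor_) (sym (S′⊕S≈ i j))) (cancel (S i j) (S′ i j))
      where
      cancel : ∀ s s′ → s xor (s′ xor s) ≡ s′
      cancel = RingSolver.solve-∀ F₂

evens : ℕ → Bool
evens 0             = true
evens 1             = false
evens (suc (suc a)) = evens a

skipThirds : ℕ → Bool
skipThirds 0                   = true
skipThirds 1                   = true
skipThirds 2                   = false
skipThirds (suc (suc (suc a))) = skipThirds a

evens-neighbours-agree : ∀ j → left evens j xor evens (suc j) ≡ false
evens-neighbours-agree zero    = refl
evens-neighbours-agree (suc j) = xor-same (evens j)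

skipThirds-neighbours : ∀ j → left skipThirds j xor skipThirds (suc j) ≡ skipThirds j
skipThirds-neighbours 0                         = refl
skipThirds-neighbours 1                         = refl
skipThirds-neighbours 2                         = refl
skipThirds-neighbours 3                         = refl
skipThirds-neighbours (suc (suc (suc (suc j)))) = skipThirds-neighbours (suc j)

-- side n = 6k − 1 for k = n + 1.
side : ℕ → ℕ
side n = 5 + n * 6

evens-side : ∀ n → evens (side n) ≡ false
evens-side zero    = refl
evens-side (suc n) = evens-side n

skipThirds-side : ∀ n → skipThirds (side n) ≡ false
skipThirds-side zero    = refl
skipThirds-side (suc n) = skipThirds-side n

kernelX kernelY : ∀ {m} → Config m
kernelX = evens ⊗ skipThirds
kernelY = skipThirds ⊗ evens

kernelXY-Φ : ∀ n → Φ {side n} kernelX ≈ ∅ × Φ {side n} kernelY ≈ ∅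
kernelXY-Φ n = ⊗-kernel evens skipThirds
  (λ i i<m → trans (adjacentParity-path (side n) i evens i<m (evens-side n)) (evens-neighbours-agree i))
  (λ j j<m → trans (adjacentParity-path (side n) j skipThirds j<m (skipThirds-side n)) (skipThirds-neighbours j))

kernelUnion : ℕ → ℕ → Bool
kernelUnion a b = (evens a ∧ skipThirds b) ∨ (skipThirds a ∧ evens b)

-- The cells with a + b ≡ 0, 1, 2 (mod 6) meet each of X ∖ Y, Y ∖ X, X ∩ Y in exactly half.
hard : ℕ → ℕ → Bool
hard a b = ((a + b) % 6 <ᵇ 3) ∨ not (kernelUnion a b)

hard-periodicʳ : ∀ a b → hard a (6 + b) ≡ hard a b
hard-periodicʳ a b = cong (λ s → (s % 6 <ᵇ 3) ∨ not (kernelUnion a b)) (x∙yz≈y∙xz a 6 b)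

hardSolution : ∀ {m} → Config m
hardSolution i j = hard (toℕ i) (toℕ j)

hardTranslate : Bool → Bool → ℕ → ℕ → Bool
hardTranslate α β a b = hard a b xor ((α ∧ (evens a ∧ skipThirds b)) xor (β ∧ (skipThirds a ∧ evens b)))

hardTranslate-periodicʳ : ∀ α β a b → hardTranslate α β a (6 + b) ≡ hardTranslate α β a b
hardTranslate-periodicʳ α β a b =
  cong (_xor ((α ∧ (evens a ∧ skipThirds b)) xor (β ∧ (skipThirds a ∧ evens b)))) (hard-periodicʳ a b)

maxClicks : ℕ → ℕ
maxClicks n = (15 + n * 20) + n * (20 + n * 26)

count-full : ∀ n → count {side n} full ≡ (25 + n * 30) + n * (30 + n * 36)
count-full n = count-periodic 5 6 n (λ _ _ → true) (λ _ _ → refl) (λ _ _ → refl)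

count-kernelX∪Y : ∀ n → count {side n} (kernelX ∪ kernelY) ≡ (20 + n * 20) + n * (20 + n * 20)
count-kernelX∪Y n = count-periodic 5 6 n kernelUnion (λ _ _ → refl) (λ _ _ → refl)

count-hard-translate : ∀ n α β → count {side n} (hardSolution ⊕ (α · kernelX ⊕ β · kernelY)) ≡ maxClicks n
count-hard-translate n false false =
  count-periodic 5 6 n (hardTranslate false false) (λ _ _ → refl) (hardTranslate-periodicʳ false false)
count-hard-translate n false true  =
  count-periodic 5 6 n (hardTranslate false true) (λ _ _ → refl) (hardTranslate-periodicʳ false true)
count-hard-translate n true  false =
  count-periodic 5 6 n (hardTranslate true false) (λ _ _ → refl) (hardTranslate-periodicʳ true false)
count-hard-translate n true  true  =
  count-periodic 5 6 n (hardTranslate true true) (λ _ _ → refl) (hardTranslate-periodicʳ true true)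

min-clicks≤maxClicks : ∀ n {C : Config (side n)} {c} → IsMinClicks C c → c ≤ maxClicks n
min-clicks≤maxClicks n {c = c} minC = *-cancelˡ-≤ 4 (+-cancelʳ-≤ (2 * union) (4 * c) (4 * maxClicks n) (begin
  4 * c + 2 * union
    ≡⟨ cong (λ u → 4 * c + 2 * u) (count-kernelX∪Y n) ⟨
  4 * c + 2 * count {side n} (kernelX ∪ kernelY)
    ≤⟨ min-clicks-bound (proj₁ (kernelXY-Φ n)) (proj₂ (kernelXY-Φ n)) minC ⟩
  4 * count {side n} full
    ≡⟨ cong (4 *_) (count-full n) ⟩
  4 * ((25 + n * 30) + n * (30 + n * 36))
    ≡⟨ area-identity n ⟩
  4 * maxClicks n + 2 * union
    ∎))
  where
  open ≤-Reasoning
  union = (20 + n * 20) + n * (20 + n * 20)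
  area-identity : ∀ n → 4 * ((25 + n * 30) + n * (30 + n * 36))
              ≡ 4 * ((15 + n * 20) + n * (20 + n * 26)) + 2 * ((20 + n * 20) + n * (20 + n * 20))
  area-identity = solve-∀

maxClicks-attained : ∀ n → KerDim (side n) 2 → IsMinClicks (Φ {side n} hardSolution) (maxClicks n)
maxClicks-attained n kerDim = min-clicks-balanced
  (kernel-spanned kerDim (proj₁ (kernelXY-Φ n)) (proj₂ (kernelXY-Φ n)) zero zero zero (suc zero) refl refl refl refl)
  (count-hard-translate n)

MostClicksAnswer : ℕ → ℕ → Set
MostClicksAnswer m N = ((c : ℕ) → IsMostClicks m c → c ≤ N) × (KerDim m 2 → IsMostClicks m N)

most-clicks-side : ∀ n → MostClicksAnswer (side n) (maxClicks n)
most-clicks-side n =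
  (λ { c ((_ , minC) , _) → min-clicks≤maxClicks n minC }) ,
  (λ kerDim → (Φ hardSolution , maxClicks-attained n kerDim) , λ _ _ → min-clicks≤maxClicks n)

theorem3 : (k : ℕ) → 1 ≤ k →
    ((n : ℕ) → IsMostClicks (6 * k ∸ 1) n → n ≤ 26 * k * k ∸ 12 * k + 1) ×
    (KerDim (6 * k ∸ 1) 2 → IsMostClicks (6 * k ∸ 1) (26 * k * k ∸ 12 * k + 1))
theorem3 zero    ()
theorem3 (suc n) _ = subst₂ MostClicksAnswer (sym side≡) (sym maxClicks≡) (most-clicks-side n)
  where
  side≡ : 6 * suc n ∸ 1 ≡ side n
  side≡ = cong (_∸ 1) (six-times n)
    where
    six-times : ∀ n → 6 * suc n ≡ 1 + (5 + n * 6)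
    six-times = solve-∀
  maxClicks≡ : 26 * suc n * suc n ∸ 12 * suc n + 1 ≡ maxClicks n
  maxClicks≡ = trans (cong (λ t → t ∸ 12 * suc n + 1) (expand n))
                     (trans (cong (_+ 1) (m+n∸n≡m (14 + n * 40 + n * n * 26) (12 * suc n))) (regroup n))
    where
    expand : ∀ n → 26 * suc n * suc n ≡ (14 + n * 40 + n * n * 26) + 12 * suc n
    expand = solve-∀
    regroup : ∀ n → (14 + n * 40 + n * n * 26) + 1 ≡ (15 + n * 20) + n * (20 + n * 26)
    regroup = solve-∀
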